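{- Let $(G,A)$ be a simple edge-weighted graph with vertices $v_1,\dots,v_n$, and let $M_1,\dots,M_n$ be a flow-up class basis of $S_G$ with $M_i\in\mathcal{F}_{i-1}$. For $i\neq j$ let $\mathcal{P}_{ij}$ be the set of paths in $G$ from $v_i$ to $v_j$, and let $[\mathcal{P}_{ij}]$ denote the least common multiple, over all $p\in\mathcal{P}_{ij}$, of $(p)$, the greatest common divisor of the weights of the edges of $p$. Then $L(M_1)=1$, and for $i>1$, $$L(M_i)=\operatorname{lcm}\big([\mathcal{P}_{i1}],[\mathcal{P}_{i2}],\dots,[\mathcal{P}_{i,i-1}]\big).$$
   Context: An edge-weighted graph $(G,A)$ is a finite simple graph $G$ with vertex set $\{v_1,\dots,v_n\}$ and edge set $E$ with a weight function $A:E\to\mathbb{Z}_{>0}$. A spline on $(G,A)$ is $(g_1,\dots,g_n)\in\mathbb{Z}^n$ with $g_i\equiv g_j\pmod{A(e)}$ for every edge $e$ joining $v_i$ and $v_j$; $S_G$ is the $\mathbb{Z}$-module of splines. A path from $v_i$ to $v_j$ is a sequence of distinct vertices $v_i=x_0,x_1,\dots,x_k=v_j$ with $x_{t-1}x_t$ an edge for each $t$. Flow-up classes: for $0\le i<n$, $\mathcal{F}_i$ is the set of splines with $g_1=\cdots=g_i=0$ and $g_{i+1}\ne0$; $\mathcal{F}_n=\{0\}$. For $F\in\mathcal{F}_i$ ($i<n$), the leading term is $L(F)=g_{i+1}$. A minimal element of $\mathcal{F}_i$ is $B\in\mathcal{F}_i$ with $L(B)>0$ and $L(B)\le|L(F)|$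 for all $F\in\mathcal{F}_i$. A flow-up class basis of $S_G$ is a $\mathbb{Z}$-basis consisting of one minimal element from each $\mathcal{F}_i$, $0\le i<n$. The lcm of an empty set of integers is taken to be $1$. -}

module Defs where

open import Data.Nat as ℕ using (ℕ; zero; suc)
open import Data.Nat.GCD using (gcd)
open import Data.Integer as ℤ using (ℤ; +_; _-_; ∣_∣)
open import Data.Integer.Divisibility as ℤD using ()
open import Data.Fin using (Fin; zero; suc; toℕ)
open import Data.List using (List; []; _∷_)
open import Data.List.Relation.Unary.Unique.Propositional using (Unique)
open import Data.Product using (Σ; _×_; ∃)
open import Relation.Binary.PropositionalEquality using (_≡_; _≢_)
open import Relation.Nullary using (¬_)

-- A finite simple edge-weighted graph on vertices Fin n (vertex v_{k+1} is index k).
-- Adj i j : there is an edge between i and j (irreflexive, symmetric: simple graph).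
-- weight i j : the weight A(e) of the edge e = {i,j} (only meaningful when Adj i j);
-- symmetric and positive on edges.
record WeightedGraph (n : ℕ) : Set₁ where
  field
    Adj       : Fin n → Fin n → Set
    irrefl    : ∀ i → ¬ Adj i i
    sym       : ∀ {i j} → Adj i j → Adj j i
    weight    : Fin n → Fin n → ℕ
    weight-sym : ∀ {i j} → Adj i j → weight i j ≡ weight j i
    weight-pos : ∀ {i j} → Adj i j → 0 ℕ.< weight i j

module _ {n : ℕ} (G : WeightedGraph n) where
  open WeightedGraph G

  IsSpline : (Fin n → ℤ) → Set
  IsSpline g = ∀ i j → Adj i j → (+ weight i j) ℤD.∣ (g i - g j)

  data Walk : Fin n → Fin n → Set where
    []  : ∀ {a} → Walk a a
    _∷_ : ∀ {a b c} → Adj a b → Walk b c → Walk a c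

  vertices : ∀ {a b} → Walk a b → List (Fin n)
  vertices {a} []      = a ∷ []
  vertices {a} (_ ∷ w) = a ∷ vertices w

  IsPath : ∀ {a b} → Walk a b → Set
  IsPath w = Unique (vertices w)

  -- (p): gcd of the weights of the edges of p (gcd with 0 for the empty tail,
  -- which is the neutral element; paths between distinct vertices have ≥ 1 edge).
  edgeGcd : ∀ {a b} → Walk a b → ℕ
  edgeGcd []                 = 0
  edgeGcd {a} (_∷_ {b = b} _ w) = gcd (weight a b) (edgeGcd w)

  PathGcds : Fin n → Fin n → ℕ → Set
  PathGcds i j x = Σ (Walk i j) λ w → IsPath w × edgeGcd w ≡ x

-- m is the least common multiple of the set of naturals P
-- (common multiple, dividing every common multiple).  The empty set has lcm 1.
IsLcmOf : (ℕ → Set) → ℕ → Set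
IsLcmOf P m = (∀ x → P x → x ℕ.∣ m) × (∀ c → (∀ x → P x → x ℕ.∣ c) → m ℕ.∣ c)
  where open import Data.Nat.Divisibility as ℕ using (_∣_)

IsPathLcm : ∀ {n} → WeightedGraph n → Fin n → Fin n → ℕ → Set
IsPathLcm G i j = IsLcmOf (PathGcds G i j)

∑ : ∀ {n} → (Fin n → ℤ) → ℤ
∑ {zero}  f = + 0
∑ {suc n} f = f zero ℤ.+ ∑ (λ k → f (suc k))

module _ {n : ℕ} (G : WeightedGraph n) where

  record Spline : Set where
    constructor spline
    field
      val      : Fin n → ℤ
      isSpline : IsSpline G val
  open Spline public

  -- Flow-up class F_k (0 ≤ k < n): g_1 = … = g_k = 0 and g_{k+1} ≠ 0,
  -- i.e. (0-indexed) val at indices < k vanish and val at k is nonzero.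
  InFlowUp : Fin n → Spline → Set
  InFlowUp k F = (∀ j → toℕ j ℕ.< toℕ k → val F j ≡ + 0) × val F k ≢ + 0

  L : Fin n → Spline → ℤ
  L k F = val F k

  IsMinimal : Fin n → Spline → Set
  IsMinimal k B = InFlowUp k B × (+ 0 ℤ.< L k B)
                × (∀ F → InFlowUp k F → L k B ℤ.≤ + ∣ L k F ∣)

  IsBasis : (Fin n → Spline) → Set
  IsBasis M = (∀ (g : Spline) → Σ (Fin n → ℤ) λ c →
                 ∀ v → val g v ≡ ∑ (λ k → c k ℤ.* val (M k) v))
            × (∀ (c : Fin n → ℤ) → (∀ v → ∑ (λ k → c k ℤ.* val (M k) v) ≡ + 0)
                 → ∀ k → c k ≡ + 0)

  -- Flow-up class basis with M_k ∈ F_{k} (0-indexed; paper: M_i ∈ F_{i-1}).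
  IsFlowUpBasis : (Fin n → Spline) → Set
  IsFlowUpBasis M = IsBasis M × (∀ k → IsMinimal k (M k))

-- Let B be the minimal element of F_k and t its leading term.  Along a path from v_k to an
-- earlier vertex v_j the spline B changes by t, so the gcd of the weights of the path divides t;
-- hence every [P_kj] with j < k divides t.  Conversely let q = p^(1+a) be a prime power dividing
-- t, and let S be the set of vertices joined to an earlier vertex by a path all of whose weights
-- are divisible by q.  If v_k ∈ S then q divides some [P_kj].  Otherwise the spline that is 0 on S
-- and N elsewhere, where every weight not divisible by q divides N but q does not, lies in F_k,
-- so t divides N, which is absurd.  Membership in S and existence of the lcm's are only available
-- under double negation here, which is harmless because divisibility is decidable.

module Submission where

open import Defs
open import Data.Nat
  using (ℕ; zero; suc; _*_; _^_; _<_; _≤_; _<?_; _≟_; s≤s; NonZero; ≢-nonZero; ≢-nonZero⁻¹)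
open import Data.Nat.Properties
  using (*-comm; *-identityˡ; *-identityʳ; m^n≢0; m<1+n⇒m<n∨m≡n; <⇒≱; n≮0)
open import Data.Nat.Divisibility
  using (_∣_; _∣?_; divides; ∣-refl; ∣-trans; _∣0; 1∣_; ∣1⇒≡1; ∣⇒≤; m∣m*n; n∣m*n
        ; *-monoˡ-∣; *-monoʳ-∣; *-pres-∣; *-cancelˡ-∣; *-cancelʳ-∣)
open import Data.Nat.DivMod using (_/_; m/n*n≡m)
open import Data.Nat.GCD using (gcd; gcd[m,n]∣m; gcd[m,n]∣n; gcd-greatest; gcd[m,n]≢0)
open import Data.Nat.LCM using (lcm; m∣lcm[m,n]; n∣lcm[m,n]; lcm-least)
open import Data.Nat.Coprimality as Coprime using (Coprime; coprime-divisor)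
open import Data.Nat.Primality using (Prime; prime⇒nonZero; prime⇒irreducible; euclidsLemma; ¬prime[1])
open import Data.Nat.Primality.Factorisation using (PrimeFactorisation; factorise)
open import Data.Nat.ListAction using (product)
open import Data.Integer as ℤ using (ℤ; +_; _-_)
import Data.Integer.Properties as ℤ
open import Data.Integer.DivMod using (_/ℕ_; _%ℕ_; a≡a%ℕn+[a/ℕn]*n; n%ℕd<d)
open import Data.Integer.Divisibility.Signed as S using ()
open import Data.Integer.Tactic.RingSolver using (solve-∀)
open import Data.Fin as Fin using (Fin; zero; suc; toℕ; fromℕ<)
open import Data.Fin.Properties using (toℕ-fromℕ<)
open import Data.List using ([]; _∷_)
open import Data.List.Membership.Propositional using (_∈_)
open import Data.List.Relation.Unary.Any using (here; there)
open import Data.List.Relation.Unary.All using (All; []; _∷_)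
open import Data.List.Relation.Unary.All.Properties.Core using (¬Any⇒All¬)
import Data.List.Relation.Unary.AllPairs as AllPairs
open import Data.Product using (Σ; Σ-syntax; _×_; _,_; proj₁; proj₂)
open import Data.Sum using (_⊎_; inj₁; inj₂)
open import Data.Unit using (⊤; tt)
open import Function using (_∘_)
open import Relation.Nullary using (¬_; Dec; yes; no)
open import Relation.Nullary.Decidable using (¬¬-excluded-middle; decidable-stable)
open import Relation.Nullary.Negation using (contradiction; ¬¬-map)
open import Relation.Binary.PropositionalEquality

∏ : ∀ {m} → (Fin m → ℕ) → ℕ
∏ {zero}  f = 1
∏ {suc m} f = f zero * ∏ (f ∘ suc)

∣∏ : ∀ {m} (f : Fin m → ℕ) i → f i ∣ ∏ f
∣∏ f zero    = m∣m*n _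
∣∏ f (suc i) = ∣-trans (∣∏ (f ∘ suc) i) (n∣m*n (f zero))

module _ {p : ℕ} (p-prime : Prime p) where
  private instance _ = prime⇒nonZero p-prime

  prime∤1 : ¬ p ∣ 1
  prime∤1 p∣1 = ¬prime[1] (subst Prime (∣1⇒≡1 p∣1) p-prime)

  prime∤⇒coprime : ∀ {m} → ¬ p ∣ m → Coprime p m
  prime∤⇒coprime p∤m (d∣p , d∣m) with prime⇒irreducible p-prime d∣p
  ... | inj₁ d≡1    = d≡1
  ... | inj₂ refl   = contradiction d∣m p∤m

  prime∣^⇒∣ : ∀ {m} k → p ∣ m ^ k → p ∣ m
  prime∣^⇒∣ zero    p∣1 = contradiction p∣1 prime∤1
  prime∣^⇒∣ {m} (suc k) p∣m^k+1 with euclidsLemma m (m ^ k) p-prime p∣m^k+1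
  ... | inj₁ p∣m   = p∣m
  ... | inj₂ p∣m^k = prime∣^⇒∣ k p∣m^k

  prime∤∏ : ∀ {m} (f : Fin m → ℕ) → (∀ i → ¬ p ∣ f i) → ¬ p ∣ ∏ f
  prime∤∏ {zero}  f _    = prime∤1
  prime∤∏ {suc m} f p∤f p∣∏ with euclidsLemma (f zero) (∏ (f ∘ suc)) p-prime p∣∏
  ... | inj₁ p∣f0 = p∤f zero p∣f0
  ... | inj₂ p∣∏′ = prime∤∏ (f ∘ suc) (p∤f ∘ suc) p∣∏′

  ∣p^[1+a]⇒≡⊎∣p^a : ∀ {d} a → d ∣ p ^ suc a → d ≡ p ^ suc a ⊎ d ∣ p ^ a
  ∣p^[1+a]⇒≡⊎∣p^a {d} a d∣ with p ∣? d
  ... | no p∤d = inj₂ (coprime-divisor (Coprime.sym (prime∤⇒coprime p∤d)) d∣)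
  ∣p^[1+a]⇒≡⊎∣p^a zero    d∣ | yes (divides d′ refl) =
    inj₁ (trans (cong (_* p) (∣1⇒≡1 (*-cancelʳ-∣ {d′} {1} p (subst (d′ * p ∣_) (*-comm p 1) d∣))))
                (*-comm 1 p))
  ∣p^[1+a]⇒≡⊎∣p^a (suc a) d∣ | yes (divides d′ refl)
    with ∣p^[1+a]⇒≡⊎∣p^a a (*-cancelʳ-∣ {d′} p (subst (d′ * p ∣_) (*-comm p (p ^ suc a)) d∣))
  ... | inj₁ d′≡ = inj₁ (trans (cong (_* p) d′≡) (*-comm (p ^ suc a) p))
  ... | inj₂ d′∣ = inj₂ (subst (d′ * p ∣_) (*-comm (p ^ a) p) (*-monoˡ-∣ p d′∣))

  gcd[w,p^a]-nonZero : ∀ w a → NonZero (gcd w (p ^ a))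
  gcd[w,p^a]-nonZero w a = ≢-nonZero (gcd[m,n]≢0 w (p ^ a) (inj₂ (≢-nonZero⁻¹ (p ^ a) {{m^n≢0 p a}})))

  ∤p^[1+a]⇒gcd∣p^a : ∀ a {w} → ¬ p ^ suc a ∣ w → gcd w (p ^ suc a) ∣ p ^ a
  ∤p^[1+a]⇒gcd∣p^a a {w} p^[1+a]∤w with ∣p^[1+a]⇒≡⊎∣p^a a (gcd[m,n]∣n w (p ^ suc a))
  ... | inj₁ gcd≡p^[1+a] = contradiction (subst (_∣ w) gcd≡p^[1+a] (gcd[m,n]∣m w _)) p^[1+a]∤w
  ... | inj₂ gcd∣p^a     = gcd∣p^a

  -- Strips the p-part off w when p^(1+a) ∤ w; junk value 1 otherwise.
  cofactor : ℕ → ℕ → ℕ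
  cofactor a w with p ^ suc a ∣? w
  ... | yes _ = 1
  ... | no _  = (w / gcd w (p ^ suc a)) {{gcd[w,p^a]-nonZero w (suc a)}}

  ∣cofactor*p^a : ∀ a {w} → ¬ p ^ suc a ∣ w → w ∣ cofactor a w * p ^ a
  ∣cofactor*p^a a {w} p^[1+a]∤w with p ^ suc a ∣? w
  ... | yes p^[1+a]∣w = contradiction p^[1+a]∣w p^[1+a]∤w
  ... | no _ = subst (_∣ w / g * p ^ a) (m/n*n≡m (gcd[m,n]∣m w _))
                     (*-monoʳ-∣ (w / g) (∤p^[1+a]⇒gcd∣p^a a p^[1+a]∤w))
    where
    g = gcd w (p ^ suc a)
    instance _ = gcd[w,p^a]-nonZero w (suc a)

  prime∤cofactor : ∀ a w → ¬ p ∣ cofactor a w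
  prime∤cofactor a w with p ^ suc a ∣? w
  ... | yes _ = prime∤1
  ... | no p^[1+a]∤w = λ p∣w/g → prime∤1 (*-cancelʳ-∣ g (subst (p * g ∣_) (sym (*-identityˡ g))
                          (gcd-greatest (p*g∣w p∣w/g) (*-monoʳ-∣ p (∤p^[1+a]⇒gcd∣p^a a p^[1+a]∤w)))))
    where
    g = gcd w (p ^ suc a)
    instance _ = gcd[w,p^a]-nonZero w (suc a)
    p*g∣w : p ∣ w / g → p * g ∣ w
    p*g∣w p∣w/g = subst (p * g ∣_) (m/n*n≡m (gcd[m,n]∣m w _)) (*-pres-∣ p∣w/g ∣-refl)

SeparatingPrimePower : ℕ → ℕ → Set
SeparatingPrimePower t c = Σ[ p ∈ ℕ ] Σ[ a ∈ ℕ ] Prime p × p ^ suc a ∣ t × ¬ p ^ suc a ∣ c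

prime∤prime^ : ∀ {p r} k → Prime p → Prime r → r ≢ p → ¬ p ∣ r ^ k
prime∤prime^ k p-prime r-prime r≢p p∣r^k with prime⇒irreducible r-prime (prime∣^⇒∣ p-prime k p∣r^k)
... | inj₁ refl = ¬prime[1] p-prime
... | inj₂ p≡r  = r≢p (sym p≡r)

∏primes∤⇒separating : ∀ {ps} c → All Prime ps → ¬ product ps ∣ c → SeparatingPrimePower (product ps) c
∏primes∤⇒separating {[]}     c []                1∤c = contradiction (1∣ c) 1∤c
∏primes∤⇒separating {p ∷ ps} c (p-prime ∷ ps-prime) ∏∤c with p ∣? c
... | no p∤c = p , 0 , p-prime , subst (_∣ p * product ps) (sym (*-identityʳ p)) (m∣m*n (product ps))
             , λ p^1∣c → p∤c (subst (_∣ c) (*-identityʳ p) p^1∣c)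
... | yes (divides c′ refl)
  with ∏primes∤⇒separating c′ ps-prime
         (λ ∏∣c′ → ∏∤c (subst (_∣ c′ * p) (*-comm (product ps) p) (*-monoˡ-∣ p ∏∣c′)))
... | r , b , r-prime , r^∣∏ , r^∤c′ with r ≟ p
...   | yes refl = r , suc b , r-prime , *-monoʳ-∣ r r^∣∏
                 , λ r^∣c → r^∤c′ (*-cancelˡ-∣ r {{prime⇒nonZero r-prime}}
                                                (subst (r * r ^ suc b ∣_) (*-comm c′ r) r^∣c))
...   | no r≢p   = r , b , r-prime , ∣-trans r^∣∏ (n∣m*n p)
                 , λ r^∣c → r^∤c′ (coprime-divisor r^[1+b]⊥p (subst (r ^ suc b ∣_) (*-comm c′ p) r^∣c))
  where
  r^[1+b]⊥p : Coprime (r ^ suc b) p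
  r^[1+b]⊥p = Coprime.sym (prime∤⇒coprime p-prime (prime∤prime^ (suc b) p-prime r-prime r≢p))

∤⇒separating : ∀ t c .{{_ : NonZero t}} → ¬ t ∣ c → SeparatingPrimePower t c
∤⇒separating t c t∤c = subst (λ t → SeparatingPrimePower t c) (sym t≡∏)
  (∏primes∤⇒separating c (PrimeFactorisation.factorsPrime f) (subst (λ t → ¬ t ∣ c) t≡∏ t∤c))
  where
  f = factorise t
  t≡∏ = PrimeFactorisation.isFactorisation f

¬¬-decidable-Fin : ∀ {n} (P : Fin n → Set) → ¬ ¬ (∀ x → Dec (P x))
¬¬-decidable-Fin {zero}  P k = k λ ()
¬¬-decidable-Fin {suc n} P k = ¬¬-excluded-middle λ P0? → ¬¬-decidable-Fin (P ∘ suc) λ P∘suc? →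
  k λ { zero → P0? ; (suc x) → P∘suc? x }

¬¬-decidable-bounded : ∀ {B} (P : ℕ → Set) → (∀ x → P x → x < B) → ¬ ¬ (∀ x → Dec (P x))
¬¬-decidable-bounded {B} P P<B k = ¬¬-decidable-Fin (P ∘ toℕ) λ P∘toℕ? → k λ x → decide x (P∘toℕ?)
  where
  decide : ∀ x → (∀ (y : Fin B) → Dec (P (toℕ y))) → Dec (P x)
  decide x P∘toℕ? with x <? B
  ... | yes x<B = subst (Dec ∘ P) (toℕ-fromℕ< x<B) (P∘toℕ? (fromℕ< x<B))
  ... | no x≮B  = no λ Px → x≮B (P<B x Px)

module _ (P : ℕ → Set) (P? : ∀ x → Dec (P x)) where

  lcm< : ℕ → ℕ
  lcm< zero    = 1
  lcm< (suc B) with P? B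
  ... | yes _ = lcm B (lcm< B)
  ... | no _  = lcm< B

  ∣lcm< : ∀ {x} B → x < B → P x → x ∣ lcm< B
  ∣lcm< {x} (suc B) x<1+B Px with P? B | m<1+n⇒m<n∨m≡n x<1+B
  ... | yes _  | inj₁ x<B  = ∣-trans (∣lcm< B x<B Px) (n∣lcm[m,n] B _)
  ... | yes _  | inj₂ refl = m∣lcm[m,n] B _
  ... | no _   | inj₁ x<B  = ∣lcm< B x<B Px
  ... | no ¬PB | inj₂ refl = contradiction Px ¬PB

  lcm<-least : ∀ {c} B → (∀ x → P x → x ∣ c) → lcm< B ∣ c
  lcm<-least {c} zero    _      = 1∣ c
  lcm<-least     (suc B) P∣c with P? B
  ... | yes PB = lcm-least (P∣c B PB) (lcm<-least B P∣c)
  ... | no _   = lcm<-least B P∣c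

¬¬-lcm-exists : ∀ {B} (P : ℕ → Set) → (∀ x → P x → x < B) → ¬ ¬ Σ ℕ (IsLcmOf P)
¬¬-lcm-exists {B} P P<B k = ¬¬-decidable-bounded P P<B λ P? →
  k (lcm< P P? B , (λ x Px → ∣lcm< P P? B (P<B x Px) Px) , λ c → lcm<-least P P? B)

x-y≡[x-y]+[y-z] : ∀ x y z → x - z ≡ (x - y) ℤ.+ (y - z)
x-y≡[x-y]+[y-z] = solve-∀

+∣+ : ∀ {a b} → a ∣ b → + a S.∣ + b
+∣+ {a} {b} = S.∣ᵤ⇒∣ {+ a} {+ b}

∣∣+u-+v∣ : ∀ {w u v} → w ∣ u → w ∣ v → w ∣ ℤ.∣ + u - + v ∣
∣∣+u-+v∣ {w} {u} {v} w∣u w∣v = S.∣⇒∣ᵤ {+ w} {+ u - + v} (S.∣m∣n⇒∣m-n (+∣+ w∣u) (+∣+ w∣v))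

[x-c*y]-[x′-c*y′] : ∀ x x′ y y′ c → (x - c ℤ.* y) - (x′ - c ℤ.* y′) ≡ (x - x′) - c ℤ.* (y - y′)
[x-c*y]-[x′-c*y′] = solve-∀

[x+y]-y≡x : ∀ x y → (x ℤ.+ y) - y ≡ x
[x+y]-y≡x = solve-∀

module _ {n} (G : WeightedGraph n) where
  open WeightedGraph G renaming (sym to Adj-sym)
  open import Data.List.Membership.DecPropositional (Fin._≟_ {n}) using (_∈?_)

  ∣-spline-edge : (g : Spline G) → ∀ {x y} → Adj x y → + weight x y S.∣ val g x - val g y
  ∣-spline-edge g {x} {y} xy = S.∣ᵤ⇒∣ {+ weight x y} {val g x - val g y} (isSpline g x y xy)

  ∣-spline-along-walk : (g : Spline G) → ∀ {a b} (w : Walk G a b) → + edgeGcd G w S.∣ val g a - val g b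
  ∣-spline-along-walk g {a} [] = subst (+ 0 S.∣_) (sym (ℤ.+-inverseʳ (val g a))) (+∣+ (0 ∣0))
  ∣-spline-along-walk g {a} {c} (_∷_ {b = b} ab w) =
    subst (_ S.∣_) (sym (x-y≡[x-y]+[y-z] (val g a) (val g b) (val g c))) (S.∣m∣n⇒∣m+n
      (S.∣-trans (+∣+ (gcd[m,n]∣m (weight a b) (edgeGcd G w))) (∣-spline-edge g ab))
      (S.∣-trans (+∣+ (gcd[m,n]∣n (weight a b) (edgeGcd G w))) (∣-spline-along-walk g w)))

  sub-multiple : Spline G → ℤ → Spline G → Spline G
  sub-multiple g c f = spline (λ x → val g x - c ℤ.* val f x) λ x y xy →
    S.∣⇒∣ᵤ (subst (_ S.∣_) (sym ([x-c*y]-[x′-c*y′] (val g x) (val g y) (val f x) (val f y) c))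
      (S.∣m∣n⇒∣m-n (∣-spline-edge g xy) (S.∣n⇒∣m*n c (∣-spline-edge f xy))))

  module _ (q : ℕ) where

    AllEdgesDivisible : ∀ {a b} → Walk G a b → Set
    AllEdgesDivisible []                  = ⊤
    AllEdgesDivisible {a} (_∷_ {b = b} _ w) = q ∣ weight a b × AllEdgesDivisible w

    ∣edgeGcd : ∀ {a b} (w : Walk G a b) → AllEdgesDivisible w → q ∣ edgeGcd G w
    ∣edgeGcd []      _            = q ∣0
    ∣edgeGcd (_ ∷ w) (q∣ab , q∣w) = gcd-greatest q∣ab (∣edgeGcd w q∣w)

    DivisiblePath : Fin n → Fin n → Set
    DivisiblePath a b = Σ (Walk G a b) λ w → IsPath G w × AllEdgesDivisible w

    suffix : ∀ {a b y} (w : Walk G a b) → IsPath G w → AllEdgesDivisible w → y ∈ vertices G w → DivisiblePath y b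
    suffix []      w-path q∣w (here refl) = [] , w-path , q∣w
    suffix (e ∷ w) w-path q∣w (here refl) = e ∷ w , w-path , q∣w
    suffix (_ ∷ w) (_ AllPairs.∷ w-path) (_ , q∣w) (there y∈w) = suffix w w-path q∣w y∈w

    -- A repeated vertex is cut away, so the result is again a path.
    prepend : ∀ {y a b} → Adj y a → q ∣ weight y a → DivisiblePath a b → DivisiblePath y b
    prepend {y} ya q∣ya (w , w-path , q∣w) with y ∈? vertices G w
    ... | yes y∈w = suffix w w-path q∣w y∈w
    ... | no  y∉w = ya ∷ w , ¬Any⇒All¬ _ y∉w AllPairs.∷ w-path , q∣ya , q∣w

  module _ {p} (p-prime : Prime p) (a : ℕ) where
    private instance _ = prime⇒nonZero p-prime

    cutHeight : ℕ
    cutHeight = ∏ (λ x → ∏ (λ y → cofactor p-prime a (weight x y))) * p ^ a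

    p^[1+a]∤cutHeight : ¬ p ^ suc a ∣ cutHeight
    p^[1+a]∤cutHeight p^[1+a]∣ =
      prime∤∏ p-prime _ (λ x → prime∤∏ p-prime _ λ y → prime∤cofactor p-prime a (weight x y))
      (*-cancelʳ-∣ (p ^ a) {{m^n≢0 p a}} p^[1+a]∣)

    ∣cutHeight : ∀ x y → ¬ p ^ suc a ∣ weight x y → weight x y ∣ cutHeight
    ∣cutHeight x y p^[1+a]∤xy = ∣-trans (∣cofactor*p^a p-prime a p^[1+a]∤xy)
      (*-monoˡ-∣ (p ^ a) (∣-trans (∣∏ _ y) (∣∏ (λ x → ∏ (λ y → cofactor p-prime a (weight x y))) x)))

  module CutSpline {p} (p-prime : Prime p) (a : ℕ) (S : Fin n → Set) (S? : ∀ x → Dec (S x))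
                   (S-closed : ∀ {x y} → Adj x y → S x → ¬ S y → ¬ p ^ suc a ∣ weight x y) where

    cutValue : ∀ {x} → Dec (S x) → ℕ
    cutValue (yes _) = 0
    cutValue (no _)  = cutHeight p-prime a

    cut-isSpline : IsSpline G (λ x → + cutValue (S? x))
    cut-isSpline x y xy with S? x | S? y
    ... | yes _  | yes _  = weight x y ∣0
    ... | no _   | no _   =
      subst (weight x y ∣_) (sym (cong ℤ.∣_∣ (ℤ.+-inverseʳ (+ cutHeight p-prime a)))) (weight x y ∣0)
    ... | yes Sx | no ¬Sy = ∣∣+u-+v∣ (weight x y ∣0) (∣cutHeight p-prime a x y (S-closed xy Sx ¬Sy))
    ... | no ¬Sx | yes Sy = ∣∣+u-+v∣ (∣cutHeight p-prime a x y p^[1+a]∤xy) (weight x y ∣0)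
      where
      p^[1+a]∤xy : ¬ p ^ suc a ∣ weight x y
      p^[1+a]∤xy = S-closed (Adj-sym xy) Sy ¬Sx ∘ subst (p ^ suc a ∣_) (weight-sym xy)

    cut : Spline G
    cut = spline (λ x → + cutValue (S? x)) cut-isSpline

    cut-∈ : ∀ {x} → S x → val cut x ≡ + 0
    cut-∈ {x} Sx with S? x
    ... | yes _  = refl
    ... | no ¬Sx = contradiction Sx ¬Sx

    cut-∉ : ∀ {x} → ¬ S x → val cut x ≡ + cutHeight p-prime a
    cut-∉ {x} ¬Sx with S? x
    ... | yes Sx = contradiction Sx ¬Sx
    ... | no _   = refl

  VanishesBelow : Fin n → Spline G → Set
  VanishesBelow k g = ∀ j → toℕ j < toℕ k → val g j ≡ + 0

  EarlierPathLcm : Fin n → ℕ → Set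
  EarlierPathLcm k x = Σ (Fin n) λ j → toℕ j < toℕ k × IsPathLcm G k j x

  module Minimal {k : Fin n} {B : Spline G} (B-min : IsMinimal G k B) where
    private
      B-vanishes : VanishesBelow k B
      B-vanishes = proj₁ (proj₁ B-min)

    lead : ℕ
    lead = ℤ.∣ val B k ∣

    val-B-k≡lead : val B k ≡ + lead
    val-B-k≡lead = sym (ℤ.0≤i⇒+∣i∣≡i (ℤ.<⇒≤ (proj₁ (proj₂ B-min))))

    instance
      lead-nonZero : NonZero lead
      lead-nonZero = ≢-nonZero λ lead≡0 →
        ℤ.<-irrefl (sym (trans val-B-k≡lead (cong +_ lead≡0))) (proj₁ (proj₂ B-min))

    -- Subtracting the right multiple of B leaves the remainder mod lead as leading term,
    -- which minimality forces to be 0.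
    module _ (g : Spline G) (g-vanishes : VanishesBelow k g) where
      private
        s = val g k /ℕ lead
        r = val g k %ℕ lead
        h = sub-multiple g s B

        v≡r+s*lead : val g k ≡ + r ℤ.+ s ℤ.* + lead
        v≡r+s*lead = a≡a%ℕn+[a/ℕn]*n (val g k) lead

        h-k≡r : val h k ≡ + r
        h-k≡r = begin
          val g k - s ℤ.* val B k               ≡⟨ cong (λ b → val g k - s ℤ.* b) val-B-k≡lead ⟩
          val g k - s ℤ.* + lead                ≡⟨ cong (_- s ℤ.* + lead) v≡r+s*lead ⟩
          (+ r ℤ.+ s ℤ.* + lead) - s ℤ.* + lead ≡⟨ [x+y]-y≡x (+ r) (s ℤ.* + lead) ⟩
          + r                                   ∎
          where open ≡-Reasoning

        h-vanishes : VanishesBelow k h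
        h-vanishes j j<k rewrite g-vanishes j j<k | B-vanishes j j<k | ℤ.*-zeroʳ s = refl

        r≢0⇒lead≤r : r ≢ 0 → lead ≤ r
        r≢0⇒lead≤r r≢0 = ℤ.drop‿+≤+ (subst₂ ℤ._≤_ val-B-k≡lead (cong (λ z → + ℤ.∣ z ∣) h-k≡r)
          (proj₂ (proj₂ B-min) h (h-vanishes , λ h-k≡0 → r≢0 (ℤ.+-injective (trans (sym h-k≡r) h-k≡0)))))

      lead∣val-k : + lead S.∣ val g k
      lead∣val-k with r ≟ 0
      ... | yes r≡0 = S.divides s
        (trans v≡r+s*lead (trans (cong (λ r → + r ℤ.+ s ℤ.* + lead) r≡0) (ℤ.+-identityˡ _)))
      ... | no r≢0  = contradiction (r≢0⇒lead≤r r≢0) (<⇒≱ (n%ℕd<d (val g k) lead))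

    walk-gcd-∣ : ∀ {j} → toℕ j < toℕ k → (w : Walk G k j) → edgeGcd G w ∣ lead
    walk-gcd-∣ {j} j<k w =
      S.∣⇒∣ᵤ {+ edgeGcd G w} {+ lead} (subst (_ S.∣_) B-k-B-j≡lead (∣-spline-along-walk B w))
      where
      B-k-B-j≡lead : val B k - val B j ≡ + lead
      B-k-B-j≡lead rewrite B-vanishes j j<k = trans (ℤ.+-identityʳ (val B k)) val-B-k≡lead

    earlierPathLcm-∣ : ∀ x → EarlierPathLcm k x → x ∣ lead
    earlierPathLcm-∣ x (j , j<k , _ , x-least) = x-least lead λ { _ (w , _ , refl) → walk-gcd-∣ j<k w }

    module _ {c} (c-multiple : ∀ x → EarlierPathLcm k x → x ∣ c) {p} (p-prime : Prime p) (a : ℕ) where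
      private
        q = p ^ suc a

      ReachesEarlier : Fin n → Set
      ReachesEarlier x = Σ (Fin n) λ j → toℕ j < toℕ k × DivisiblePath q x j

      reachesEarlier-closed : ∀ {x y} → Adj x y → ReachesEarlier x → ¬ ReachesEarlier y → ¬ q ∣ weight x y
      reachesEarlier-closed xy (j , j<k , x⇝j) ¬y⇝ q∣xy =
        ¬y⇝ (j , j<k , prepend q (Adj-sym xy) (subst (q ∣_) (weight-sym xy) q∣xy) x⇝j)

      reaches⇒∣c : ReachesEarlier k → ¬ ¬ q ∣ c
      reaches⇒∣c (j , j<k , w , w-path , q∣w) = ¬¬-map q∣c (¬¬-lcm-exists (PathGcds G k j) path-gcd<1+lead)
        where
        path-gcd<1+lead : ∀ y → PathGcds G k j y → y < suc lead
        path-gcd<1+lead _ (w′ , _ , refl) = s≤s (∣⇒≤ (walk-gcd-∣ j<k w′))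
        q∣c : Σ ℕ (IsLcmOf (PathGcds G k j)) → q ∣ c
        q∣c (x , x-lcm) = ∣-trans (∣edgeGcd q w q∣w)
                          (∣-trans (proj₁ x-lcm _ (w , w-path , refl)) (c-multiple x (j , j<k , x-lcm)))

      ¬reaches⇒∤lead : (∀ x → Dec (ReachesEarlier x)) → ¬ ReachesEarlier k → ¬ q ∣ lead
      ¬reaches⇒∤lead reaches? ¬k⇝ q∣lead = p^[1+a]∤cutHeight p-prime a (∣-trans q∣lead
        (S.∣⇒∣ᵤ {+ lead} {+ cutHeight p-prime a}
          (subst (+ lead S.∣_) (cut-∉ ¬k⇝) (lead∣val-k cut cut-vanishes))))
        where
        open CutSpline p-prime a ReachesEarlier reaches? reachesEarlier-closed
        cut-vanishes : VanishesBelow k cut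
        cut-vanishes j j<k = cut-∈ (j , j<k , [] , [] AllPairs.∷ AllPairs.[] , tt)

      p^[1+a]∣lead⇒∣c : q ∣ lead → q ∣ c
      p^[1+a]∣lead⇒∣c q∣lead = decidable-stable (q ∣? c) λ q∤c →
        ¬¬-decidable-Fin ReachesEarlier λ reaches? → conclude reaches? q∤c
        where
        conclude : (∀ x → Dec (ReachesEarlier x)) → ¬ ¬ q ∣ c
        conclude reaches? with reaches? k
        ... | yes k⇝ = reaches⇒∣c k⇝
        ... | no ¬k⇝ = λ _ → ¬reaches⇒∤lead reaches? ¬k⇝ q∣lead

    ∣-commonMultiple : ∀ c → (∀ x → EarlierPathLcm k x → x ∣ c) → lead ∣ c
    ∣-commonMultiple c c-multiple = decidable-stable (lead ∣? c) λ lead∤c →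
      let (p , a , p-prime , q∣lead , q∤c) = ∤⇒separating lead c lead∤c
      in  q∤c (p^[1+a]∣lead⇒∣c c-multiple p-prime a q∣lead)

    lead-isLcm : IsLcmOf (EarlierPathLcm k) lead
    lead-isLcm = earlierPathLcm-∣ , ∣-commonMultiple

theorem5p4 : ∀ {n} (G : WeightedGraph n) (M : Fin n → Spline G) →
    IsFlowUpBasis G M →
    (∀ (k : Fin n) → toℕ k ≡ 0 → L G k (M k) ≡ + 1) ×
    (∀ (k : Fin n) → toℕ k ≢ 0 →
      Σ ℕ λ m →
        IsLcmOf (λ x → Σ (Fin n) λ j → toℕ j < toℕ k × IsPathLcm G k j x) m
        × L G k (M k) ≡ + m)
theorem5p4 {n} G M (_ , M-minimal) = leading-one , λ k _ → lead k , lead-isLcm k , val-B-k≡lead k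
  where
  open module Leading (k : Fin n) = Minimal G {k} {M k} (M-minimal k)

  -- The lcm of the empty family of [P_kj] is 1.
  leading-one : ∀ k → toℕ k ≡ 0 → L G k (M k) ≡ + 1
  leading-one k k≡0 = trans (val-B-k≡lead k) (cong +_ (∣1⇒≡1 (proj₂ (lead-isLcm k) 1 nothing-earlier)))
    where
    nothing-earlier : ∀ x → EarlierPathLcm G k x → x ∣ 1
    nothing-earlier _ (j , j<k , _) = contradiction (subst (toℕ j <_) k≡0 j<k) n≮0
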